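{- Let $q$ be a power of the prime $p$, let $r,v,k,t$ be positive integers, and let $f(x):=x^r h_k(x^v)^t$ where $h_k(x)=x^{k-1}+x^{k-2}+\dots+1$. Put $s:=\gcd(v,q-1)$ and $d:=(q-1)/s$. If $d=1$, then $f$ permutes $\mathbb{F}_q$ if and only if $\gcd(k,p)=\gcd(r,s)=1$. If $d=2$, then $f$ permutes $\mathbb{F}_q$ if and only if $\gcd(k,2p)=\gcd(r,s)=1$ and $k^{st}\equiv(-1)^{r+1}\pmod p$.
   Context: A polynomial permutes $\mathbb{F}_q$ if the map $\mathbb{F}_q\to\mathbb{F}_q$ it induces is a bijection. -}

module Defs where

open import Level using (Level; _⊔_)
open import Data.Nat using (ℕ; zero; suc; _∸_)
open import Data.Fin using (Fin)
open import Data.Product using (Σ; ∃; _×_)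
open import Relation.Nullary using (¬_)
open import Relation.Binary.PropositionalEquality using (_≡_)
open import Algebra.Bundles using (CommutativeRing)

module _ {c ℓ : Level} (R : CommutativeRing c ℓ) where
  open CommutativeRing R

  pow : Carrier → ℕ → Carrier
  pow x zero    = 1#
  pow x (suc n) = x * pow x n

  natCast : ℕ → Carrier
  natCast zero    = 0#
  natCast (suc n) = 1# + natCast n

  IsField : Set (c ⊔ ℓ)
  IsField = (¬ (1# ≈ 0#)) × (∀ x → ¬ (x ≈ 0#) → ∃ λ y → (x * y) ≈ 1#)

  HasCard : ℕ → Set (c ⊔ ℓ)
  HasCard q = Σ (Fin q → Carrier) λ e →
                (∀ i j → e i ≈ e j → i ≡ j) × (∀ x → ∃ λ i → e i ≈ x)

  HasChar : ℕ → Set ℓ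
  HasChar p = natCast p ≈ 0#

  Permutes : (Carrier → Carrier) → Set (c ⊔ ℓ)
  Permutes g = (∀ x y → g x ≈ g y → x ≈ y) × (∀ y → ∃ λ x → g x ≈ y)

  h : ℕ → Carrier → Carrier
  h zero    x = 0#
  h (suc k) x = pow x k + h k x

  f : ℕ → ℕ → ℕ → ℕ → Carrier → Carrier
  f r v k t x = pow x r * pow (h k (pow x v)) t

-- Write N = q - 1 and c₀ = hₖ(1)ᵗ = kᵗ·1.  By Fermat (xᴺ = 1 for x ≠ 0) the value
-- xᵛ equals xˢ, which is 1 when d = 1 and ±1 when d = 2.  Hence f(x) = xʳ c₀ on
-- the squares (xˢ = 1), and f(x) = xʳ hₖ(-1)ᵗ on the non-squares (xˢ = -1),
-- where hₖ(-1) is 0 or 1 as k is even or odd.  On each class f is injective iff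
-- gcd(r, s) = 1 (x ↦ (xʳ, xˢ) is injective for coprime exponents, and a common
-- divisor g ≥ 2 yields a g-th root of unity z ≠ 1 with f(z) = f(1)); for d = 2
-- the two image classes are told apart by f(x)ˢ, equal to c₀ˢ resp. (-1)ʳ, and
-- they are disjoint iff c₀ˢ = (-1)^(r+1), i.e. k^(st) ≡ (-1)^(r+1) (mod p).
module Submission where

open import Defs
open import Level using (Level)
open import Data.Nat using (ℕ; _∸_; _≥_; _^_; _*_; _+_)
open import Data.Nat.GCD using (gcd)
open import Data.Nat.Primality using (Prime)
open import Data.Product using (Σ; _×_)
open import Relation.Binary.PropositionalEquality using (_≡_)
open import Function.Bundles using (_⇔_)
open import Data.Integer using (ℤ; +_; -_; _-_) renaming (_^_ to _^ℤ_)
open import Data.Integer.Divisibility renaming (_∣_ to _∣ℤ_)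
open import Algebra.Bundles using (CommutativeRing)

open import Data.Nat using (zero; suc; pred; _≤_; _<_; s≤s; z≤n)
import Data.Nat.Properties as ℕP
open import Data.Nat.Divisibility using (_∣_; _∣?_; ∣1⇒≡1; ∣-refl; ∣-trans; ∣-antisym; 0∣⇒≡0; m∣m*n; n∣m*n; ∣m+n∣m⇒∣n)
open import Data.Nat.GCD using (module Bézout; gcd-GCD; gcd-greatest; gcd[m,n]∣m; gcd[m,n]∣n; gcd[m,n]≢0)
open Data.Nat.GCD.GCD using (GCD)
open import Data.Nat.Coprimality using (Coprime; coprime-Bézout; gcd≡1⇒coprime; coprime⇒gcd≡1; coprime-divisor)
import Data.Nat.Coprimality as Coprimality
open import Data.Nat.Primality using (prime⇒irreducible; irreducible[2]; prime⇒nonTrivial)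
open import Data.Integer using (∣_∣)
open import Data.Product using (_,_; proj₁; proj₂; ∃)
open import Data.Sum using (_⊎_; inj₁; inj₂)
open import Data.Empty using (⊥-elim)
open import Relation.Nullary using (¬_; Dec; yes; no)
open import Relation.Nullary.Decidable using (¬?; decidable-stable)
open import Relation.Binary.PropositionalEquality as ≡ using (_≢_; refl)
open import Function.Bundles using (mk⇔; Equivalence)
open import Data.Fin as Fin using (Fin)
import Data.Fin.Properties as FinP
open import Data.Vec using (Vec; []; _∷_; replicate)
open import Data.Fin.Permutation using (Permutation; permutation; _⟨$⟩ʳ_)
import Algebra.Properties.CommutativeMonoid.Sum

2≢1 : 2 ≢ 1
2≢1 ()

even-or-odd : ∀ n → (∃ λ j → n ≡ j + j) ⊎ (∃ λ j → n ≡ suc (j + j))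
even-or-odd zero = inj₁ (0 , refl)
even-or-odd (suc n) with even-or-odd n
... | inj₁ (j , n≡j+j)   = inj₂ (j , ≡.cong suc n≡j+j)
... | inj₂ (j , n≡1+j+j) = inj₁ (suc j , ≡.trans (≡.cong suc n≡1+j+j) (≡.cong suc (≡.sym (ℕP.+-suc j j))))

j+j≡j*2 : ∀ j → j + j ≡ j * 2
j+j≡j*2 j = ≡.trans (≡.cong (λ m → j + m) (≡.sym (ℕP.+-identityʳ j))) (ℕP.*-comm 2 j)

2∣⇒even : ∀ {n} → 2 ∣ n → ∃ λ j → n ≡ j + j
2∣⇒even (divides j n≡j*2) = j , ≡.trans n≡j*2 (≡.sym (j+j≡j*2 j))

¬2∣⇒odd : ∀ {n} → ¬ (2 ∣ n) → ∃ λ j → n ≡ suc (j + j)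
¬2∣⇒odd {n} 2∤n with even-or-odd n
... | inj₂ odd = odd
... | inj₁ (j , n≡j+j) = ⊥-elim (2∤n (divides j (≡.trans n≡j+j (j+j≡j*2 j))))

-1ℤ^even : ∀ j → (- (+ 1)) ^ℤ (j + j) ≡ + 1
-1ℤ^even zero = refl
-1ℤ^even (suc j) rewrite ℕP.+-suc j j | -1ℤ^even j = refl

-1ℤ^odd : ∀ j → (- (+ 1)) ^ℤ suc (j + j) ≡ - (+ 1)
-1ℤ^odd j rewrite -1ℤ^even j = refl

∣K-[-1]^[r+1]∣ : ∀ K' r → let K = suc K' in
    (∃ λ j → r ≡ j + j × ∣ (+ K) - (- (+ 1)) ^ℤ (r + 1) ∣ ≡ K + 1)
  ⊎ (∃ λ j → r ≡ suc (j + j) × ∣ (+ K) - (- (+ 1)) ^ℤ (r + 1) ∣ ≡ K')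
∣K-[-1]^[r+1]∣ K' r with even-or-odd r
... | inj₁ (j , refl) = inj₁ (j , refl , ≡.cong (λ e → ∣ (+ suc K') - e ∣)
        (≡.trans (≡.cong ((- (+ 1)) ^ℤ_) (ℕP.+-comm (j + j) 1)) (-1ℤ^odd j)))
... | inj₂ (j , refl) = inj₂ (j , refl , ≡.cong (λ e → ∣ (+ suc K') - e ∣)
        (≡.trans (≡.cong ((- (+ 1)) ^ℤ_) (≡.trans (ℕP.+-comm (suc (j + j)) 1) (≡.cong suc (≡.sym (ℕP.+-suc j j)))))
                 (-1ℤ^even (suc j))))

module PrimeFacts (p : ℕ) (p-prime : Prime p) where

  p≢1 : p ≢ 1
  p≢1 = Data.Nat.nonTrivial⇒≢1 {{prime⇒nonTrivial p-prime}}

  ∤⇒coprime : ∀ {m} → ¬ (p ∣ m) → Coprime p m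
  ∤⇒coprime {m} p∤m {d} (d∣p , d∣m) with prime⇒irreducible p-prime d∣p
  ... | inj₁ d≡1 = d≡1
  ... | inj₂ d≡p = ⊥-elim (p∤m (≡.subst (_∣ m) d≡p d∣m))

  gcd≡1⇒∤ : ∀ {k} → gcd k p ≡ 1 → ¬ (p ∣ k)
  gcd≡1⇒∤ gcd≡1 p∣k = p≢1 (∣1⇒≡1 (≡.subst (p ∣_) gcd≡1 (gcd-greatest p∣k ∣-refl)))

  ∤⇒gcd≡1 : ∀ {k} → ¬ (p ∣ k) → gcd k p ≡ 1
  ∤⇒gcd≡1 p∤k = coprime⇒gcd≡1 (Coprimality.sym (∤⇒coprime p∤k))

  gcd[k,2p]≡1⇒ : ∀ {k} → gcd k (2 * p) ≡ 1 → ¬ (2 ∣ k) × ¬ (p ∣ k)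
  gcd[k,2p]≡1⇒ gcd≡1 =
      (λ 2∣k → 2≢1 (∣1⇒≡1 (≡.subst (2 ∣_) gcd≡1 (gcd-greatest 2∣k (m∣m*n p)))))
    , (λ p∣k → p≢1 (∣1⇒≡1 (≡.subst (p ∣_) gcd≡1 (gcd-greatest p∣k (n∣m*n 2)))))

  ⇒gcd[k,2p]≡1 : ∀ {k} → ¬ (2 ∣ k) → ¬ (p ∣ k) → gcd k (2 * p) ≡ 1
  ⇒gcd[k,2p]≡1 {k} 2∤k p∤k = coprime⇒gcd≡1 coprime
    where
    -- a common divisor d of k and 2p is odd, hence divides p, hence is 1
    coprime : Coprime k (2 * p)
    coprime {d} (d∣k , d∣2p) with prime⇒irreducible p-prime (coprime-divisor d⊥2 d∣2p)
      where
      d⊥2 : Coprime d 2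
      d⊥2 {e} (e∣d , e∣2) with irreducible[2] e∣2
      ... | inj₁ e≡1 = e≡1
      ... | inj₂ e≡2 = ⊥-elim (2∤k (≡.subst (_∣ k) e≡2 (∣-trans e∣d d∣k)))
    ... | inj₁ d≡1 = d≡1
    ... | inj₂ d≡p = ⊥-elim (p∤k (≡.subst (_∣ k) d≡p d∣k))

  odd-power⇒p≢2 : ∀ s n → suc (s + s) ≡ p ^ suc n → p ≢ 2
  odd-power⇒p≢2 s n 1+s+s≡pⁿ refl = 2≢1 (∣1⇒≡1 (∣m+n∣m⇒∣n 2∣s+s+1 2∣s+s))
    where
    2∣s+s : 2 ∣ s + s
    2∣s+s = divides s (j+j≡j*2 s)
    2∣s+s+1 : 2 ∣ (s + s) + 1
    2∣s+s+1 = ≡.subst (2 ∣_) (≡.trans (≡.sym 1+s+s≡pⁿ) (ℕP.+-comm 1 (s + s))) (m∣m*n (2 ^ n))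

module FieldFacts {c ℓ : Level} (F : CommutativeRing c ℓ) (isField : IsField F)
                  (_≈?_ : ∀ x y → Dec (CommutativeRing._≈_ F x y)) where
  open CommutativeRing F renaming (_+_ to _⊕_; _*_ to _·_; -_ to neg; refl to ≈-refl) hiding (_-_)
  open import Relation.Binary.Reasoning.Setoid setoid
  open import Algebra.Solver.Ring.NaturalCoefficients.Default commutativeSemiring

  infixr 8 _^ᶠ_
  _^ᶠ_ : Carrier → ℕ → Carrier
  _^ᶠ_ = pow F

  ι : ℕ → Carrier
  ι = natCast F

  -1# : Carrier
  -1# = neg 1#
  open import Algebra.Properties.Ring ring using (-1*x≈-x; -‿involutive; +-inverseˡ-unique; +-cancelˡ)

  1≉0 : ¬ (1# ≈ 0#)
  1≉0 = proj₁ isField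

  cancelˡ : ∀ {a x y} → ¬ (a ≈ 0#) → a · x ≈ a · y → x ≈ y
  cancelˡ {a} {x} {y} a≉0 ax≈ay with proj₂ isField a a≉0
  ... | b , ab≈1 = begin
    x               ≈⟨ sym (*-identityˡ x) ⟩
    1# · x          ≈⟨ *-congʳ (sym ab≈1) ⟩
    (a · b) · x     ≈⟨ reassoc x ⟩
    b · (a · x)     ≈⟨ *-congˡ ax≈ay ⟩
    b · (a · y)     ≈⟨ reassoc y ⟨
    (a · b) · y     ≈⟨ *-congʳ ab≈1 ⟩
    1# · y          ≈⟨ *-identityˡ y ⟩
    y               ∎
    where
    reassoc : ∀ z → (a · b) · z ≈ b · (a · z)
    reassoc z = solve 3 (λ a b z → (a :* b) :* z := b :* (a :* z)) ≈-refl a b z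

  cancelʳ : ∀ {a x y} → ¬ (a ≈ 0#) → x · a ≈ y · a → x ≈ y
  cancelʳ a≉0 xa≈ya = cancelˡ a≉0 (trans (*-comm _ _) (trans xa≈ya (*-comm _ _)))

  ·-nonzero : ∀ {x y} → ¬ (x ≈ 0#) → ¬ (y ≈ 0#) → ¬ (x · y ≈ 0#)
  ·-nonzero {x} x≉0 y≉0 xy≈0 = y≉0 (cancelˡ x≉0 (trans xy≈0 (sym (zeroʳ x))))

  ^-cong : ∀ {x y} n → x ≈ y → x ^ᶠ n ≈ y ^ᶠ n
  ^-cong zero    x≈y = ≈-refl
  ^-cong (suc n) x≈y = *-cong x≈y (^-cong n x≈y)

  ^-+ : ∀ x m n → x ^ᶠ (m + n) ≈ x ^ᶠ m · x ^ᶠ n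
  ^-+ x zero    n = sym (*-identityˡ _)
  ^-+ x (suc m) n = trans (*-congˡ (^-+ x m n)) (sym (*-assoc _ _ _))

  ^-* : ∀ x m n → x ^ᶠ (m * n) ≈ (x ^ᶠ m) ^ᶠ n
  ^-* x m zero    rewrite ℕP.*-zeroʳ m = ≈-refl
  ^-* x m (suc n) rewrite ℕP.*-suc m n = trans (^-+ x m (m * n)) (*-congˡ (^-* x m n))

  ^-swap : ∀ x m n → (x ^ᶠ m) ^ᶠ n ≈ (x ^ᶠ n) ^ᶠ m
  ^-swap x m n = begin
    (x ^ᶠ m) ^ᶠ n  ≈⟨ ^-* x m n ⟨
    x ^ᶠ (m * n)   ≡⟨ ≡.cong (x ^ᶠ_) (ℕP.*-comm m n) ⟩
    x ^ᶠ (n * m)   ≈⟨ ^-* x n m ⟩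
    (x ^ᶠ n) ^ᶠ m  ∎

  ·-^ : ∀ x y n → (x · y) ^ᶠ n ≈ x ^ᶠ n · y ^ᶠ n
  ·-^ x y zero    = sym (*-identityˡ _)
  ·-^ x y (suc n) = trans (*-congˡ (·-^ x y n))
    (solve 4 (λ x y a b → (x :* y) :* (a :* b) := (x :* a) :* (y :* b)) ≈-refl x y (x ^ᶠ n) (y ^ᶠ n))

  1^ : ∀ n → 1# ^ᶠ n ≈ 1#
  1^ zero    = ≈-refl
  1^ (suc n) = trans (*-identityˡ _) (1^ n)

  ^-zero : ∀ {x} n → 1 ≤ n → x ≈ 0# → x ^ᶠ n ≈ 0#
  ^-zero (suc n) _ x≈0 = trans (*-congʳ x≈0) (zeroˡ _)

  ^-nonzero : ∀ {x} n → ¬ (x ≈ 0#) → ¬ (x ^ᶠ n ≈ 0#)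
  ^-nonzero zero    x≉0 = 1≉0
  ^-nonzero (suc n) x≉0 = ·-nonzero x≉0 (^-nonzero n x≉0)

  ^-multiple : ∀ {z m b} → m ∣ b → z ^ᶠ m ≈ 1# → z ^ᶠ b ≈ 1#
  ^-multiple {z} {m} (divides j refl) zᵐ≈1 = begin
    z ^ᶠ (j * m)    ≡⟨ ≡.cong (z ^ᶠ_) (ℕP.*-comm j m) ⟩
    z ^ᶠ (m * j)    ≈⟨ ^-* z m j ⟩
    (z ^ᶠ m) ^ᶠ j   ≈⟨ ^-cong j zᵐ≈1 ⟩
    1# ^ᶠ j         ≈⟨ 1^ j ⟩
    1#              ∎

  ^-bézout : ∀ {z} m r b a → z ^ᶠ m ≈ 1# → z ^ᶠ r ≈ 1# → suc (b * m) ≡ a * r → z ≈ 1#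
  ^-bézout {z} m r b a zᵐ≈1 zʳ≈1 1+bm≡ar = begin
    z                    ≈⟨ *-identityʳ z ⟨
    z · 1#               ≈⟨ *-congˡ (^-multiple (n∣m*n b) zᵐ≈1) ⟨
    z ^ᶠ suc (b * m)     ≡⟨ ≡.cong (z ^ᶠ_) 1+bm≡ar ⟩
    z ^ᶠ (a * r)         ≈⟨ ^-multiple (n∣m*n a) zʳ≈1 ⟩
    1#                   ∎

  coprime-orders⇒1 : ∀ {z} r m → gcd r m ≡ 1 → z ^ᶠ r ≈ 1# → z ^ᶠ m ≈ 1# → z ≈ 1#
  coprime-orders⇒1 r m gcd≡1 zʳ≈1 zᵐ≈1 with coprime-Bézout (gcd≡1⇒coprime gcd≡1)
  ... | Bézout.+- a b 1+bm≡ar = ^-bézout m r b a zᵐ≈1 zʳ≈1 1+bm≡ar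
  ... | Bézout.-+ a b 1+ar≡bm = ^-bézout r m a b zʳ≈1 zᵐ≈1 1+ar≡bm

  coprime-powers-injective : ∀ {x y} r m → gcd r m ≡ 1 → ¬ (y ≈ 0#) →
                             x ^ᶠ r ≈ y ^ᶠ r → x ^ᶠ m ≈ y ^ᶠ m → x ≈ y
  coprime-powers-injective {x} {y} r m gcd≡1 y≉0 xʳ≈yʳ xᵐ≈yᵐ with proj₂ isField y y≉0
  ... | y⁻¹ , yy⁻¹≈1 = begin
    x                ≈⟨ *-identityʳ x ⟨
    x · 1#           ≈⟨ *-congˡ yy⁻¹≈1 ⟨
    x · (y · y⁻¹)    ≈⟨ solve 3 (λ x y y⁻¹ → x :* (y :* y⁻¹) := (x :* y⁻¹) :* y) ≈-refl x y y⁻¹ ⟩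
    (x · y⁻¹) · y    ≈⟨ *-congʳ (coprime-orders⇒1 r m gcd≡1 (quotient r xʳ≈yʳ) (quotient m xᵐ≈yᵐ)) ⟩
    1# · y           ≈⟨ *-identityˡ y ⟩
    y                ∎
    where
    quotient : ∀ n → x ^ᶠ n ≈ y ^ᶠ n → (x · y⁻¹) ^ᶠ n ≈ 1#
    quotient n xⁿ≈yⁿ = begin
      (x · y⁻¹) ^ᶠ n       ≈⟨ ·-^ x y⁻¹ n ⟩
      x ^ᶠ n · y⁻¹ ^ᶠ n    ≈⟨ *-congʳ xⁿ≈yⁿ ⟩
      y ^ᶠ n · y⁻¹ ^ᶠ n    ≈⟨ ·-^ y y⁻¹ n ⟨
      (y · y⁻¹) ^ᶠ n       ≈⟨ ^-cong n yy⁻¹≈1 ⟩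
      1# ^ᶠ n              ≈⟨ 1^ n ⟩
      1#                   ∎

  -1·x+x≈0 : ∀ x → -1# · x ⊕ x ≈ 0#
  -1·x+x≈0 x = trans (+-congʳ (-1*x≈-x x)) (-‿inverseˡ x)

  -1·-1≈1 : -1# · -1# ≈ 1#
  -1·-1≈1 = trans (-1*x≈-x -1#) (-‿involutive 1#)

  -1≉0 : ¬ (-1# ≈ 0#)
  -1≉0 -1≈0 = 1≉0 (trans (sym -1·-1≈1) (trans (*-congˡ -1≈0) (zeroʳ -1#)))

  -1^even : ∀ j → -1# ^ᶠ (j + j) ≈ 1#
  -1^even zero = ≈-refl
  -1^even (suc j) rewrite ℕP.+-suc j j = begin
    -1# · (-1# · -1# ^ᶠ (j + j))  ≈⟨ *-assoc _ _ _ ⟨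
    (-1# · -1#) · -1# ^ᶠ (j + j)  ≈⟨ *-cong -1·-1≈1 (-1^even j) ⟩
    1# · 1#                       ≈⟨ *-identityˡ 1# ⟩
    1#                            ∎

  -1^odd : ∀ j → -1# ^ᶠ suc (j + j) ≈ -1#
  -1^odd j = trans (*-congˡ (-1^even j)) (*-identityʳ -1#)

  -- The only square roots of 1 are 1 and -1: y² = 1 gives (y + 1) y = y + 1.
  square-root-of-1 : ∀ {y} → y · y ≈ 1# → y ≈ 1# ⊎ y ≈ -1#
  square-root-of-1 {y} y²≈1 with (y ⊕ 1#) ≈? 0#
  ... | yes y+1≈0 = inj₂ (+-inverseˡ-unique y 1# y+1≈0)
  ... | no  y+1≉0 = inj₁ (cancelˡ y+1≉0 (begin
    (y ⊕ 1#) · y      ≈⟨ distribʳ y y 1# ⟩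
    y · y ⊕ 1# · y    ≈⟨ +-cong y²≈1 (*-identityˡ y) ⟩
    1# ⊕ y            ≈⟨ +-comm 1# y ⟩
    y ⊕ 1#            ≈⟨ *-identityʳ _ ⟨
    (y ⊕ 1#) · 1#     ∎))

  ι-+ : ∀ m n → ι (m + n) ≈ ι m ⊕ ι n
  ι-+ zero    n = sym (+-identityˡ _)
  ι-+ (suc m) n = trans (+-congˡ (ι-+ m n)) (sym (+-assoc _ _ _))

  ι-* : ∀ m n → ι (m * n) ≈ ι m · ι n
  ι-* zero    n = sym (zeroˡ _)
  ι-* (suc m) n = begin
    ι (n + m * n)              ≈⟨ ι-+ n (m * n) ⟩
    ι n ⊕ ι (m * n)            ≈⟨ +-cong (sym (*-identityˡ _)) (ι-* m n) ⟩
    1# · ι n ⊕ ι m · ι n       ≈⟨ distribʳ _ _ _ ⟨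
    (1# ⊕ ι m) · ι n           ∎

  ι-^ : ∀ m n → ι (m ^ n) ≈ ι m ^ᶠ n
  ι-^ m zero    = +-identityʳ 1#
  ι-^ m (suc n) = trans (ι-* m (m ^ n)) (*-congˡ (ι-^ m n))

  ι-suc : ∀ m → ι (m + 1) ≈ ι m ⊕ 1#
  ι-suc m = trans (ι-+ m 1) (+-congˡ (+-identityʳ 1#))

  h-cong : ∀ k {x y} → x ≈ y → h F k x ≈ h F k y
  h-cong zero    x≈y = ≈-refl
  h-cong (suc k) x≈y = +-cong (^-cong k x≈y) (h-cong k x≈y)

  h[1] : ∀ k → h F k 1# ≈ ι k
  h[1] zero    = ≈-refl
  h[1] (suc k) = +-cong (1^ k) (h[1] k)

  h-even[-1] : ∀ j → h F (j + j) -1# ≈ 0#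
  h-even[-1] zero = ≈-refl
  h-even[-1] (suc j) rewrite ℕP.+-suc j j = begin
    -1# ^ᶠ suc (j + j) ⊕ (-1# ^ᶠ (j + j) ⊕ h F (j + j) -1#)   ≈⟨ +-assoc _ _ _ ⟨
    (-1# · -1# ^ᶠ (j + j) ⊕ -1# ^ᶠ (j + j)) ⊕ h F (j + j) -1# ≈⟨ +-cong (-1·x+x≈0 _) (h-even[-1] j) ⟩
    0# ⊕ 0#                                                   ≈⟨ +-identityˡ 0# ⟩
    0#                                                        ∎

  h-odd[-1] : ∀ j → h F (suc (j + j)) -1# ≈ 1#
  h-odd[-1] j = trans (+-cong (-1^even j) (h-even[-1] j)) (+-identityʳ 1#)

  -- A monic polynomial xⁿ + aₙ₋₁xⁿ⁻¹ + ... + a₀ of degree n, given by the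
  -- coefficient vector a₀ ∷ ... ∷ aₙ₋₁, evaluated by Horner's rule.
  eval : ∀ {n} → Vec Carrier n → Carrier → Carrier
  eval []       x = 1#
  eval (a ∷ as) x = x · eval as x ⊕ a

  -- Synthetic division of a monic Q of degree n+1 by x - c gives a monic D of
  -- degree n with Q(x) - Q(c) = (x - c) D(x), stated without subtraction.
  divide : ∀ {n} → Vec Carrier (suc n) → Carrier → Vec Carrier n
  divide (a ∷ [])     c = []
  divide (a ∷ b ∷ bs) c = eval (b ∷ bs) c ∷ divide (b ∷ bs) c

  division-identity : ∀ {n} (Q : Vec Carrier (suc n)) c x →
    eval Q x ⊕ c · eval (divide Q c) x ≈ x · eval (divide Q c) x ⊕ eval Q c
  division-identity (a ∷ []) c x =
    solve 3 (λ x a c → (x :* con 1 :+ a) :+ c :* con 1 := x :* con 1 :+ (c :* con 1 :+ a)) ≈-refl x a c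
  division-identity (a ∷ b ∷ bs) c x = begin
    (x · Qx ⊕ a) ⊕ c · (x · Dx ⊕ Qc)      ≈⟨ solve 6 (λ x Qx a c Dx Qc →
                                               (x :* Qx :+ a) :+ c :* (x :* Dx :+ Qc)
                                            := x :* (Qx :+ c :* Dx) :+ (c :* Qc :+ a)) ≈-refl x Qx a c Dx Qc ⟩
    x · (Qx ⊕ c · Dx) ⊕ (c · Qc ⊕ a)      ≈⟨ +-congʳ (*-congˡ (division-identity (b ∷ bs) c x)) ⟩
    x · (x · Dx ⊕ Qc) ⊕ (c · Qc ⊕ a)      ∎
    where
    Qx = eval (b ∷ bs) x
    Qc = eval (b ∷ bs) c
    Dx = eval (divide (b ∷ bs) c) x

  root-of-quotient : ∀ {n} (Q : Vec Carrier (suc n)) {c d} → ¬ (c ≈ d) →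
                     eval Q c ≈ 0# → eval Q d ≈ 0# → eval (divide Q c) d ≈ 0#
  root-of-quotient Q {c} {d} c≉d Qc≈0 Qd≈0 with eval (divide Q c) d ≈? 0#
  ... | yes Dd≈0 = Dd≈0
  ... | no  Dd≉0 = ⊥-elim (c≉d (cancelʳ Dd≉0 (begin
    c · D              ≈⟨ +-identityˡ _ ⟨
    0# ⊕ c · D         ≈⟨ +-congʳ Qd≈0 ⟨
    eval Q d ⊕ c · D   ≈⟨ division-identity Q c d ⟩
    d · D ⊕ eval Q c   ≈⟨ +-congˡ Qc≈0 ⟩
    d · D ⊕ 0#         ≈⟨ +-identityʳ _ ⟩
    d · D              ∎)))
    where D = eval (divide Q c) d

  root-bound : ∀ n (Q : Vec Carrier n) (ρ : Fin (suc n) → Carrier) →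
               (∀ i j → ρ i ≈ ρ j → i ≡ j) → ¬ (∀ i → eval Q (ρ i) ≈ 0#)
  root-bound zero    []  ρ ρ-inj roots = 1≉0 (roots Fin.zero)
  root-bound (suc n) Q   ρ ρ-inj roots =
    root-bound n (divide Q (ρ Fin.zero)) (λ i → ρ (Fin.suc i))
      (λ i j ρi≈ρj → FinP.suc-injective (ρ-inj _ _ ρi≈ρj))
      (λ i → root-of-quotient Q (λ ρ₀≈ρᵢ → FinP.0≢1+n (ρ-inj _ _ ρ₀≈ρᵢ)) (roots Fin.zero) (roots (Fin.suc i)))

  -- In particular x^(j+2) = x, i.e. x^(j+2) - x = 0, has at most j + 2 solutions.
  xⁿ-x : ∀ j → Vec Carrier (suc (suc j))
  xⁿ-x j = 0# ∷ -1# ∷ replicate j 0#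

  eval-xⁿ : ∀ j x → eval (replicate j 0#) x ≈ x ^ᶠ j
  eval-xⁿ zero    x = ≈-refl
  eval-xⁿ (suc j) x = trans (+-identityʳ _) (*-congˡ (eval-xⁿ j x))

  root-of-xⁿ-x : ∀ j x → x ^ᶠ suc (suc j) ≈ x → eval (xⁿ-x j) x ≈ 0#
  root-of-xⁿ-x j x xⁿ≈x = begin
    x · (x · eval (replicate j 0#) x ⊕ -1#) ⊕ 0#   ≈⟨ +-identityʳ _ ⟩
    x · (x · eval (replicate j 0#) x ⊕ -1#)        ≈⟨ distribˡ _ _ _ ⟩
    x · (x · eval (replicate j 0#) x) ⊕ x · -1#    ≈⟨ +-congʳ (*-congˡ (*-congˡ (eval-xⁿ j x))) ⟩
    x ^ᶠ suc (suc j) ⊕ x · -1#                     ≈⟨ +-congʳ xⁿ≈x ⟩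
    x ⊕ x · -1#                                    ≈⟨ +-congʳ (*-identityʳ x) ⟨
    x · 1# ⊕ x · -1#                               ≈⟨ distribˡ _ _ _ ⟨
    x · (1# ⊕ -1#)                                 ≈⟨ *-congˡ (-‿inverseʳ 1#) ⟩
    x · 0#                                         ≈⟨ zeroʳ x ⟩
    0#                                             ∎

Fin-injective⇒surjective : ∀ {n} (g : Fin n → Fin n) → (∀ i j → g i ≡ g j → i ≡ j) → ∀ t → ∃ λ i → g i ≡ t
Fin-injective⇒surjective {zero}  g g-inj ()
Fin-injective⇒surjective {suc m} g g-inj t with FinP.any? (λ i → g i FinP.≟ t)
... | yes hit = hit
... | no  miss = ⊥-elim (ℕP.<-irrefl ≡.refl (FinP.injective⇒≤ {f = g′} g′-injective))
  where
  -- missing t, g squeezes Fin (suc m) injectively into Fin m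
  g′ : Fin (suc m) → Fin m
  g′ i = Fin.punchOut {i = t} {j = g i} (λ t≡gi → miss (i , ≡.sym t≡gi))
  g′-injective : ∀ {i j} → g′ i ≡ g′ j → i ≡ j
  g′-injective {i} {j} g′i≡g′j = g-inj i j
    (FinP.punchOut-injective {i = t} (λ t≡gi → miss (i , ≡.sym t≡gi)) (λ t≡gj → miss (j , ≡.sym t≡gj)) g′i≡g′j)

module _ {c ℓ : Level} (F : CommutativeRing c ℓ) where
  open CommutativeRing F using (Carrier; _≈_; sym; trans; reflexive)

  finite⇒decidable : ∀ {q} → HasCard F q → ∀ (x y : Carrier) → Dec (x ≈ y)
  finite⇒decidable (e , e-inj , e-surj) x y with proj₁ (e-surj x) FinP.≟ proj₁ (e-surj y)
  ... | yes i≡j = yes (trans (sym (proj₂ (e-surj x))) (trans (reflexive (≡.cong e i≡j)) (proj₂ (e-surj y))))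
  ... | no  i≢j = no (λ x≈y → i≢j (e-inj _ _ (trans (proj₂ (e-surj x)) (trans x≈y (sym (proj₂ (e-surj y)))))))

module FiniteField {c ℓ : Level} (F : CommutativeRing c ℓ) (isField : IsField F) (N : ℕ)
                   (card : HasCard F (suc N)) where
  open CommutativeRing F renaming (_+_ to _⊕_; _*_ to _·_; -_ to neg; refl to ≈-refl) hiding (_-_)
  open import Relation.Binary.Reasoning.Setoid setoid
  open import Algebra.Solver.Ring.NaturalCoefficients.Default commutativeSemiring

  infix 4 _≈?_
  _≈?_ : ∀ x y → Dec (x ≈ y)
  _≈?_ = finite⇒decidable F card

  open FieldFacts F isField _≈?_ public

  e : Fin (suc N) → Carrier
  e = proj₁ card

  e-injective : ∀ i j → e i ≈ e j → i ≡ j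
  e-injective = proj₁ (proj₂ card)

  index : Carrier → Fin (suc N)
  index x = proj₁ (proj₂ (proj₂ card) x)

  e-index : ∀ x → e (index x) ≈ x
  e-index x = proj₂ (proj₂ (proj₂ card) x)

  injective⇒surjective : (g : Carrier → Carrier) → (∀ x y → g x ≈ g y → x ≈ y) → ∀ y → ∃ λ x → g x ≈ y
  injective⇒surjective g g-inj y with Fin-injective⇒surjective G G-inj (index y)
    where
    G : Fin (suc N) → Fin (suc N)
    G i = index (g (e i))
    G-inj : ∀ i j → G i ≡ G j → i ≡ j
    G-inj i j Gi≡Gj = e-injective i j (g-inj _ _ (trans (sym (e-index _)) (trans (reflexive (≡.cong e Gi≡Gj)) (e-index _))))
  ... | i , Gi≡y = e i , trans (sym (e-index _)) (trans (reflexive (≡.cong e Gi≡y)) (e-index y))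

  nonzero : Fin N → Carrier
  nonzero j = e (Fin.punchIn (index 0#) j)

  nonzero-injective : ∀ i j → nonzero i ≈ nonzero j → i ≡ j
  nonzero-injective i j ei≈ej = FinP.punchIn-injective (index 0#) i j (e-injective _ _ ei≈ej)

  nonzero-≉0 : ∀ j → ¬ (nonzero j ≈ 0#)
  nonzero-≉0 j ej≈0 = FinP.punchInᵢ≢i (index 0#) j (e-injective _ _ (trans ej≈0 (sym (e-index 0#))))

  nonzero-surjective : ∀ y → ¬ (y ≈ 0#) → ∃ λ j → nonzero j ≈ y
  nonzero-surjective y y≉0 =
    Fin.punchOut i₀≢iy , trans (reflexive (≡.cong e (FinP.punchIn-punchOut i₀≢iy))) (e-index y)
    where
    i₀≢iy : index 0# ≢ index y
    i₀≢iy i₀≡iy = y≉0 (trans (sym (e-index y)) (trans (reflexive (≡.cong e (≡.sym i₀≡iy))) (e-index 0#)))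

  scaling : ∀ a → ¬ (a ≈ 0#) → Σ (Permutation N N) λ π → ∀ j → nonzero (π ⟨$⟩ʳ j) ≈ a · nonzero j
  scaling a a≉0 = permutation σ τ στ τσ , σ-spec
    where
    a⁻¹ = proj₁ (proj₂ isField a a≉0)
    aa⁻¹≈1 : a · a⁻¹ ≈ 1#
    aa⁻¹≈1 = proj₂ (proj₂ isField a a≉0)
    a⁻¹≉0 : ¬ (a⁻¹ ≈ 0#)
    a⁻¹≉0 a⁻¹≈0 = 1≉0 (trans (sym aa⁻¹≈1) (trans (*-congˡ a⁻¹≈0) (zeroʳ a)))
    scale : ∀ b → ¬ (b ≈ 0#) → Fin N → Fin N
    scale b b≉0 j = proj₁ (nonzero-surjective (b · nonzero j) (·-nonzero b≉0 (nonzero-≉0 j)))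
    scale-spec : ∀ b b≉0 j → nonzero (scale b b≉0 j) ≈ b · nonzero j
    scale-spec b b≉0 j = proj₂ (nonzero-surjective (b · nonzero j) (·-nonzero b≉0 (nonzero-≉0 j)))
    σ τ : Fin N → Fin N
    σ = scale a a≉0
    τ = scale a⁻¹ a⁻¹≉0
    σ-spec = scale-spec a a≉0
    inverse : ∀ b b′ b≉0 b′≉0 → b · b′ ≈ 1# → ∀ j → scale b b≉0 (scale b′ b′≉0 j) ≡ j
    inverse b b′ b≉0 b′≉0 bb′≈1 j = nonzero-injective _ _ (begin
      nonzero (scale b b≉0 (scale b′ b′≉0 j))  ≈⟨ scale-spec b b≉0 _ ⟩
      b · nonzero (scale b′ b′≉0 j)            ≈⟨ *-congˡ (scale-spec b′ b′≉0 j) ⟩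
      b · (b′ · nonzero j)                     ≈⟨ *-assoc _ _ _ ⟨
      (b · b′) · nonzero j                     ≈⟨ *-congʳ bb′≈1 ⟩
      1# · nonzero j                           ≈⟨ *-identityˡ _ ⟩
      nonzero j                                ∎)
    στ : ∀ j → σ (τ j) ≡ j
    στ = inverse a a⁻¹ a≉0 a⁻¹≉0 aa⁻¹≈1
    τσ : ∀ j → τ (σ j) ≡ j
    τσ = inverse a⁻¹ a a⁻¹≉0 a≉0 (trans (*-comm _ _) aa⁻¹≈1)

  module Π = Algebra.Properties.CommutativeMonoid.Sum *-commutativeMonoid

  ∏-scale : ∀ n (t : Fin n → Carrier) a → Π.sum (λ j → a · t j) ≈ a ^ᶠ n · Π.sum t
  ∏-scale zero    t a = sym (*-identityˡ _)
  ∏-scale (suc n) t a = begin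
    (a · t Fin.zero) · Π.sum (λ j → a · t (Fin.suc j))  ≈⟨ *-congˡ (∏-scale n (λ j → t (Fin.suc j)) a) ⟩
    (a · t Fin.zero) · (a ^ᶠ n · rest)                   ≈⟨ solve 4 (λ a t₀ aⁿ S → (a :* t₀) :* (aⁿ :* S)
                                                            := (a :* aⁿ) :* (t₀ :* S)) ≈-refl a (t Fin.zero) (a ^ᶠ n) rest ⟩
    (a · a ^ᶠ n) · (t Fin.zero · rest)                   ∎
    where rest = Π.sum (λ j → t (Fin.suc j))

  ∏-nonzero : ∀ n (t : Fin n → Carrier) → (∀ j → ¬ (t j ≈ 0#)) → ¬ (Π.sum t ≈ 0#)
  ∏-nonzero zero    t t≉0 = 1≉0
  ∏-nonzero (suc n) t t≉0 = ·-nonzero (t≉0 Fin.zero) (∏-nonzero n (λ j → t (Fin.suc j)) (λ j → t≉0 (Fin.suc j)))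

  -- Fermat's little theorem: a^N = 1 for a ≠ 0.  Scaling the product of all
  -- nonzero elements by a permutes its factors, so it multiplies it by aᴺ = 1.
  fermat : ∀ a → ¬ (a ≈ 0#) → a ^ᶠ N ≈ 1#
  fermat a a≉0 = cancelˡ (∏-nonzero N nonzero nonzero-≉0) (begin
    Π.sum nonzero · a ^ᶠ N                  ≈⟨ *-comm _ _ ⟩
    a ^ᶠ N · Π.sum nonzero                  ≈⟨ ∏-scale N nonzero a ⟨
    Π.sum (λ j → a · nonzero j)             ≈⟨ Π.sum-cong-≋ (λ j → proj₂ (scaling a a≉0) j) ⟨
    Π.sum (λ j → nonzero (π ⟨$⟩ʳ j))         ≈⟨ Π.sum-permute nonzero π ⟨
    Π.sum nonzero                           ≈⟨ *-identityʳ _ ⟨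
    Π.sum nonzero · 1#                      ∎)
    where π = proj₁ (scaling a a≉0)

  -- For j + 1 < N, some nonzero x has x^(j+1) ≠ 1: otherwise all N + 1
  -- elements would be roots of x^(j+2) - x, contradicting the root bound.
  non-root : ∀ j → suc j < N → ∃ λ x → ¬ (x ≈ 0#) × ¬ (x ^ᶠ suc j ≈ 1#)
  non-root j j+1<N with FinP.any? (λ i → ¬? (e i ^ᶠ suc (suc j) ≈? e i))
  ... | yes (i , eᵢ-nonroot) = e i , eᵢ≉0 , eᵢ^[j+1]≉1
    where
    eᵢ≉0 : ¬ (e i ≈ 0#)
    eᵢ≉0 eᵢ≈0 = eᵢ-nonroot (trans (^-zero (suc (suc j)) (s≤s z≤n) eᵢ≈0) (sym eᵢ≈0))
    eᵢ^[j+1]≉1 : ¬ (e i ^ᶠ suc j ≈ 1#)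
    eᵢ^[j+1]≉1 eᵢ^[j+1]≈1 = eᵢ-nonroot (trans (*-congˡ eᵢ^[j+1]≈1) (*-identityʳ _))
  ... | no no-nonroot = ⊥-elim (root-bound (suc (suc j)) (xⁿ-x j) ρ ρ-injective
                                  (λ i → root-of-xⁿ-x j (ρ i) (all-roots _)))
    where
    all-roots : ∀ i → e i ^ᶠ suc (suc j) ≈ e i
    all-roots i = decidable-stable (_ ≈? _) (λ nonroot → no-nonroot (i , nonroot))
    j+3≤N+1 : suc (suc (suc j)) ≤ suc N
    j+3≤N+1 = s≤s j+1<N
    ρ : Fin (suc (suc (suc j))) → Carrier
    ρ i = e (Fin.inject≤ i j+3≤N+1)
    ρ-injective : ∀ i k → ρ i ≈ ρ k → i ≡ k
    ρ-injective i k ρi≈ρk = FinP.inject≤-injective j+3≤N+1 j+3≤N+1 i k (e-injective _ _ ρi≈ρk)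

  -- If g ≥ 2 divides N (N ≥ 1), there is z ≠ 1 with zᵍ = 1: write N = (j+1) g
  -- and take z = x^(j+1) for x a non-root of x^(j+1) = 1, so zᵍ = xᴺ = 1.
  nontrivial-root-of-unity : ∀ g → 2 ≤ g → g ∣ N → 1 ≤ N → ∃ λ z → ¬ (z ≈ 1#) × z ^ᶠ g ≈ 1#
  nontrivial-root-of-unity g g≥2 (divides zero    N≡0) N≥1 = ⊥-elim (ℕP.<⇒≢ N≥1 (≡.sym N≡0))
  nontrivial-root-of-unity g g≥2 (divides (suc j) N≡[j+1]g) N≥1
    with non-root j (≡.subst (suc j <_) (≡.sym N≡[j+1]g) (ℕP.m<m*n (suc j) g g≥2))
  ... | x , x≉0 , x^[j+1]≉1 = x ^ᶠ suc j , x^[j+1]≉1 , (begin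
    (x ^ᶠ suc j) ^ᶠ g   ≈⟨ ^-* x (suc j) g ⟨
    x ^ᶠ (suc j * g)    ≡⟨ ≡.cong (x ^ᶠ_) (≡.sym N≡[j+1]g) ⟩
    x ^ᶠ N              ≈⟨ fermat x x≉0 ⟩
    1#                  ∎)

module Characteristic {c ℓ : Level} (F : CommutativeRing c ℓ) (isField : IsField F)
                      (_≈?_ : ∀ x y → Dec (CommutativeRing._≈_ F x y))
                      (p : ℕ) (p-prime : Prime p) (char : HasChar F p) where
  open CommutativeRing F renaming (_+_ to _⊕_; _*_ to _·_; -_ to neg; refl to ≈-refl) hiding (_-_)
  open import Relation.Binary.Reasoning.Setoid setoid
  open import Algebra.Properties.Ring ring using (+-inverseˡ-unique; +-cancelˡ)
  open FieldFacts F isField _≈?_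
  open PrimeFacts p p-prime

  -- m·1 = 0 exactly when p ∣ m (for p ∤ m, Bézout gives consecutive multiples
  -- of p and of m, which cannot both vanish).
  multiple-of-zero : ∀ j {m} → ι m ≈ 0# → ι (j * m) ≈ 0#
  multiple-of-zero j {m} ιm≈0 = trans (ι-* j m) (trans (*-congˡ ιm≈0) (zeroʳ _))

  ∣⇒ι≈0 : ∀ {m} → p ∣ m → ι m ≈ 0#
  ∣⇒ι≈0 (divides j refl) = multiple-of-zero j char

  consecutive-zeros : ∀ a → ι a ≈ 0# → ¬ (ι (suc a) ≈ 0#)
  consecutive-zeros a ιa≈0 ι[1+a]≈0 = 1≉0 (begin
    1#          ≈⟨ +-identityʳ 1# ⟨
    1# ⊕ 0#     ≈⟨ +-congˡ ιa≈0 ⟨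
    ι (suc a)   ≈⟨ ι[1+a]≈0 ⟩
    0#          ∎)

  ι≈0⇒∣ : ∀ {m} → ι m ≈ 0# → p ∣ m
  ι≈0⇒∣ {m} ιm≈0 with p ∣? m
  ... | yes p∣m = p∣m
  ... | no  p∤m with coprime-Bézout (∤⇒coprime p∤m)
  ...   | Bézout.+- x y 1+ym≡xp = ⊥-elim (consecutive-zeros (y * m) (multiple-of-zero y ιm≈0)
                                    (≡.subst (λ n → ι n ≈ 0#) (≡.sym 1+ym≡xp) (multiple-of-zero x char)))
  ...   | Bézout.-+ x y 1+xp≡ym = ⊥-elim (consecutive-zeros (x * p) (multiple-of-zero x char)
                                    (≡.subst (λ n → ι n ≈ 0#) (≡.sym 1+xp≡ym) (multiple-of-zero y ιm≈0)))

  congruence⇔ : ∀ K' r → (+ p) ∣ℤ ((+ suc K') - (- (+ 1)) ^ℤ (r + 1)) ⇔ (ι (suc K') ≈ -1# ^ᶠ suc r)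
  congruence⇔ K' r with ∣K-[-1]^[r+1]∣ K' r
  ... | inj₁ (j , refl , ∣d∣≡K+1) = mk⇔
    (λ p∣d → trans (+-inverseˡ-unique _ 1# (trans (sym (ι-suc (suc K'))) (∣⇒ι≈0 (≡.subst (p ∣_) ∣d∣≡K+1 p∣d))))
                   (sym (-1^odd j)))
    (λ ιK≈-1 → ≡.subst (p ∣_) (≡.sym ∣d∣≡K+1) (ι≈0⇒∣ (begin
      ι (suc K' + 1)    ≈⟨ ι-suc (suc K') ⟩
      ι (suc K') ⊕ 1#   ≈⟨ +-congʳ (trans ιK≈-1 (-1^odd j)) ⟩
      -1# ⊕ 1#          ≈⟨ -‿inverseˡ 1# ⟩
      0#                ∎)))
  ... | inj₂ (j , refl , ∣d∣≡K') = mk⇔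
    (λ p∣d → begin
      1# ⊕ ι K'                 ≈⟨ +-congˡ (∣⇒ι≈0 (≡.subst (p ∣_) ∣d∣≡K' p∣d)) ⟩
      1# ⊕ 0#                   ≈⟨ +-identityʳ 1# ⟩
      1#                        ≈⟨ -1^[2+j+j] ⟨
      -1# ^ᶠ suc (suc (j + j))  ∎)
    (λ ιK≈1 → ≡.subst (p ∣_) (≡.sym ∣d∣≡K') (ι≈0⇒∣ (+-cancelˡ 1# _ _ (trans (trans ιK≈1 -1^[2+j+j]) (sym (+-identityʳ 1#))))))
    where
    -1^[2+j+j] : -1# ^ᶠ suc (suc (j + j)) ≈ 1#
    -1^[2+j+j] = ≡.subst (λ n → -1# ^ᶠ n ≈ 1#) (≡.cong suc (ℕP.+-suc j j)) (-1^even (suc j))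

  -- In odd characteristic 2 ≠ 0, so no nonzero σ satisfies σ = -σ.
  σ≉-σ : p ≢ 2 → ∀ {σ} → ¬ (σ ≈ 0#) → ¬ (σ ≈ -1# · σ)
  σ≉-σ p≢2 {σ} σ≉0 σ≈-σ = ·-nonzero 2≉0 σ≉0 (begin
    (1# ⊕ 1#) · σ        ≈⟨ distribʳ σ 1# 1# ⟩
    1# · σ ⊕ 1# · σ      ≈⟨ +-cong (*-identityˡ σ) (*-identityˡ σ) ⟩
    σ ⊕ σ                ≈⟨ +-congʳ σ≈-σ ⟩
    -1# · σ ⊕ σ          ≈⟨ -1·x+x≈0 σ ⟩
    0#                   ∎)
    where
    2≉0 : ¬ (1# ⊕ 1# ≈ 0#)
    2≉0 2≈0 with irreducible[2] (ι≈0⇒∣ {2} (trans (+-congˡ (+-identityʳ 1#)) 2≈0))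
    ... | inj₁ p≡1 = p≢1 p≡1
    ... | inj₂ p≡2 = p≢2 p≡2

-- We write c₀ = hₖ(1)ᵗ = kᵗ·1, and s = gcd(v, N)
-- is given by its specification, so that gcd itself is never unfolded.
module Setting {c ℓ : Level} (F : CommutativeRing c ℓ) (isField : IsField F)
               (p : ℕ) (p-prime : Prime p) (N n : ℕ) (q≡pⁿ : suc N ≡ p ^ suc n)
               (card : HasCard F (suc N)) (char : HasChar F p)
               (r v k t : ℕ) (r≥1 : r ≥ 1) (k≥1 : k ≥ 1) (t≥1 : t ≥ 1)
               (s : ℕ) (s-gcd : GCD v N s) where
  open CommutativeRing F renaming (_+_ to _⊕_; _*_ to _·_; -_ to neg; refl to ≈-refl) hiding (_-_)
  open import Relation.Binary.Reasoning.Setoid setoid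
  open FiniteField F isField N card
  open Characteristic F isField _≈?_ p p-prime char
  open PrimeFacts p p-prime

  f′ : Carrier → Carrier
  f′ = f F r v k t

  c₀ : Carrier
  c₀ = ι k ^ᶠ t

  N≥1 : N ≥ 1
  N≥1 = ℕP.≤-pred (≡.subst (2 ≤_) (≡.sym q≡pⁿ)
          (ℕP.*-mono-≤ (Data.Nat.nonTrivial⇒n>1 p {{prime⇒nonTrivial p-prime}}) (ℕP.m^n>0 p {{p≢0}} n)))
    where p≢0 = Data.Nat.nonTrivial⇒nonZero p {{prime⇒nonTrivial p-prime}}

  open GCD s-gcd using () renaming (gcd∣m to s∣v; gcd∣n to s∣N; greatest to s-greatest)

  s≢0 : s ≢ 0
  s≢0 s≡0 = ℕP.n>0⇒n≢0 N≥1 (0∣⇒≡0 (≡.subst (_∣ N) s≡0 s∣N))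

  f-zero : ∀ {x} → x ≈ 0# → f′ x ≈ 0#
  f-zero x≈0 = trans (*-congʳ (^-zero r r≥1 x≈0)) (zeroˡ _)

  f-on-roots : ∀ {x} → x ^ᶠ v ≈ 1# → f′ x ≈ x ^ᶠ r · c₀
  f-on-roots xᵛ≈1 = *-congˡ (^-cong t (trans (h-cong k xᵛ≈1) (h[1] k)))

  f-one : f′ 1# ≈ c₀
  f-one = trans (f-on-roots (1^ v)) (trans (*-congʳ (1^ r)) (*-identityˡ _))

  c₀≉0 : ¬ (p ∣ k) → ¬ (c₀ ≈ 0#)
  c₀≉0 p∤k = ^-nonzero t (λ ιk≈0 → p∤k (ι≈0⇒∣ ιk≈0))

  -- Necessary conditions common to both cases.  If p ∣ k then f(1) = 0 = f(0).
  injective⇒p∤k : (∀ x y → f′ x ≈ f′ y → x ≈ y) → ¬ (p ∣ k)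
  injective⇒p∤k f-inj p∣k = 1≉0 (f-inj 1# 0# (trans f-one (trans (^-zero t t≥1 (∣⇒ι≈0 p∣k)) (sym (f-zero ≈-refl)))))

  -- If g ≥ 2 divides r and s, a z ≠ 1 with zᵍ = 1 has zʳ = zᵛ = 1, so f(z) = c₀ = f(1).
  injective⇒no-common-divisor : (∀ x y → f′ x ≈ f′ y → x ≈ y) → ∀ g → 2 ≤ g → g ∣ r → ¬ (g ∣ s)
  injective⇒no-common-divisor f-inj g g≥2 g∣r g∣s
    with nontrivial-root-of-unity g g≥2 (∣-trans g∣s s∣N) N≥1
  ... | z , z≉1 , zᵍ≈1 = z≉1 (f-inj z 1# (begin
    f′ z            ≈⟨ f-on-roots (^-multiple (∣-trans g∣s s∣v) zᵍ≈1) ⟩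
    z ^ᶠ r · c₀     ≈⟨ *-congʳ (^-multiple g∣r zᵍ≈1) ⟩
    1# · c₀         ≈⟨ *-identityˡ c₀ ⟩
    c₀              ≈⟨ f-one ⟨
    f′ 1#           ∎))

  injective⇒gcd[r,s]≡1 : (∀ x y → f′ x ≈ f′ y → x ≈ y) → gcd r s ≡ 1
  injective⇒gcd[r,s]≡1 f-inj with gcd r s in g≡gcd
  ... | zero         = ⊥-elim (gcd[m,n]≢0 r s (inj₁ (ℕP.n>0⇒n≢0 r≥1)) g≡gcd)
  ... | suc zero     = ≡.refl
  ... | suc (suc g′) = ⊥-elim (injective⇒no-common-divisor f-inj (suc (suc g′)) (s≤s (s≤s z≤n))
                                (≡.subst (_∣ r) g≡gcd (gcd[m,n]∣m r s)) (≡.subst (_∣ s) g≡gcd (gcd[m,n]∣n r s)))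

  permutes-from-nonzero : (∀ x → ¬ (x ≈ 0#) → ¬ (f′ x ≈ 0#)) →
    (∀ x y → ¬ (x ≈ 0#) → ¬ (y ≈ 0#) → f′ x ≈ f′ y → x ≈ y) → Permutes F f′
  permutes-from-nonzero f≉0 f-inj* = f-inj , injective⇒surjective f′ f-inj
    where
    f-inj : ∀ x y → f′ x ≈ f′ y → x ≈ y
    f-inj x y fx≈fy with x ≈? 0# | y ≈? 0#
    ... | yes x≈0 | yes y≈0 = trans x≈0 (sym y≈0)
    ... | yes x≈0 | no  y≉0 = ⊥-elim (f≉0 y y≉0 (trans (sym fx≈fy) (f-zero x≈0)))
    ... | no  x≉0 | yes y≈0 = ⊥-elim (f≉0 x x≉0 (trans fx≈fy (f-zero y≈0)))
    ... | no  x≉0 | no  y≉0 = f-inj* x y x≉0 y≉0 fx≈fy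

  module Case-d≡1 (N≡1*s : N ≡ 1 * s) where

    s≡N : s ≡ N
    s≡N = ≡.sym (≡.trans N≡1*s (ℕP.*-identityˡ s))

    -- N ∣ v, so by Fermat every nonzero x is a v-th root of unity and f(x) = xʳ c₀
    f-nonzero : ∀ x → ¬ (x ≈ 0#) → f′ x ≈ x ^ᶠ r · c₀
    f-nonzero x x≉0 = f-on-roots (^-multiple (≡.subst (_∣ v) s≡N s∣v) (fermat x x≉0))

    -- with c₀ ≠ 0, f(x) = f(y) gives xʳ = yʳ, and xᴺ = yᴺ = 1 by Fermat
    sufficient : ¬ (p ∣ k) → gcd r s ≡ 1 → Permutes F f′
    sufficient p∤k gcd[r,s]≡1 = permutes-from-nonzero f≉0 f-injective
      where
      f≉0 : ∀ x → ¬ (x ≈ 0#) → ¬ (f′ x ≈ 0#)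
      f≉0 x x≉0 fx≈0 = ·-nonzero (^-nonzero r x≉0) (c₀≉0 p∤k) (trans (sym (f-nonzero x x≉0)) fx≈0)
      f-injective : ∀ x y → ¬ (x ≈ 0#) → ¬ (y ≈ 0#) → f′ x ≈ f′ y → x ≈ y
      f-injective x y x≉0 y≉0 fx≈fy = coprime-powers-injective r N (≡.subst (λ m → gcd r m ≡ 1) s≡N gcd[r,s]≡1) y≉0
        (cancelʳ (c₀≉0 p∤k) (trans (sym (f-nonzero x x≉0)) (trans fx≈fy (f-nonzero y y≉0))))
        (trans (fermat x x≉0) (sym (fermat y y≉0)))

    proposition : Permutes F f′ ⇔ (gcd k p ≡ 1 × gcd r s ≡ 1)
    proposition = mk⇔
      (λ (f-inj , _) → ∤⇒gcd≡1 (injective⇒p∤k f-inj) , injective⇒gcd[r,s]≡1 f-inj)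
      (λ (gcd[k,p]≡1 , gcd[r,s]≡1) → sufficient (gcd≡1⇒∤ gcd[k,p]≡1) gcd[r,s]≡1)

  -- Case d = 2, i.e. N = 2s.  Nonzero x are squares (xˢ = 1) or non-squares (xˢ = -1).
  module Case-d≡2 (N≡2*s : N ≡ 2 * s) where

    N≡s+s : N ≡ s + s
    N≡s+s = ≡.trans N≡2*s (≡.cong (λ m → s + m) (ℕP.+-identityʳ s))

    p≢2 : p ≢ 2
    p≢2 = odd-power⇒p≢2 s n (≡.trans (≡.cong suc (≡.sym N≡s+s)) q≡pⁿ)

    -- (opaque, so that `with` on it does not unfold the proof of Fermat's theorem)
    opaque
      -- xˢ is a square root of xᴺ = 1
      square-class : ∀ x → ¬ (x ≈ 0#) → x ^ᶠ s ≈ 1# ⊎ x ^ᶠ s ≈ -1#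
      square-class x x≉0 = square-root-of-1 (begin
        x ^ᶠ s · x ^ᶠ s   ≈⟨ ^-+ x s s ⟨
        x ^ᶠ (s + s)      ≡⟨ ≡.cong (x ^ᶠ_) (≡.sym N≡s+s) ⟩
        x ^ᶠ N            ≈⟨ fermat x x≉0 ⟩
        1#                ∎)

    j+j*s≡j*N : ∀ j → (j + j) * s ≡ j * N
    j+j*s≡j*N j = ≡.trans (ℕP.*-distribʳ-+ s j j)
                    (≡.trans (≡.sym (ℕP.*-distribˡ-+ j s s)) (≡.cong (λ m → j * m) (≡.sym N≡s+s)))

    -- v is an odd multiple of s: an even one would make N = 2s divide s
    v≡s+jN : ∃ λ j → v ≡ s + j * N
    v≡s+jN with s∣v
    ... | divides u v≡us with even-or-odd u
    ...   | inj₂ (j , refl) = j , ≡.trans v≡us (≡.cong (λ m → s + m) (j+j*s≡j*N j))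
    ...   | inj₁ (j , refl) = ⊥-elim (ℕP.<-irrefl ≡.refl (≡.subst (N <_) (≡.sym N≡N+N) (ℕP.m<m+n N N≥1)))
      where
      N≡N+N : N ≡ N + N
      N≡N+N = ≡.trans N≡s+s (≡.cong (λ m → m + m) (∣-antisym s∣N
                (s-greatest (divides j (≡.trans v≡us (j+j*s≡j*N j)) , ∣-refl))))

    xᵛ≈xˢ : ∀ x → ¬ (x ≈ 0#) → x ^ᶠ v ≈ x ^ᶠ s
    xᵛ≈xˢ x x≉0 with v≡s+jN
    ... | j , v≡s+jN′ = begin
      x ^ᶠ v                    ≡⟨ ≡.cong (x ^ᶠ_) v≡s+jN′ ⟩
      x ^ᶠ (s + j * N)          ≈⟨ ^-+ x s (j * N) ⟩
      x ^ᶠ s · x ^ᶠ (j * N)     ≈⟨ *-congˡ (^-multiple (n∣m*n j) (fermat x x≉0)) ⟩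
      x ^ᶠ s · 1#               ≈⟨ *-identityʳ _ ⟩
      x ^ᶠ s                    ∎

    1+pred[s]≡s : suc (pred s) ≡ s
    1+pred[s]≡s = ℕP.suc-pred s {{Data.Nat.≢-nonZero s≢0}}

    s<N : s < N
    s<N = ≡.subst (s <_) (≡.sym N≡s+s) (ℕP.m<m+n s (≡.subst (1 ≤_) 1+pred[s]≡s (s≤s z≤n)))

    -- a non-square exists: since s < N, some nonzero x has xˢ ≠ 1
    non-square : ∃ λ x → ¬ (x ≈ 0#) × x ^ᶠ s ≈ -1#
    non-square with non-root (pred s) (≡.subst (_< N) (≡.sym 1+pred[s]≡s) s<N)
    ... | x , x≉0 , xˢ≉1 with square-class x x≉0
    ...   | inj₁ xˢ≈1  = ⊥-elim (xˢ≉1 (≡.subst (λ m → x ^ᶠ m ≈ 1#) (≡.sym 1+pred[s]≡s) xˢ≈1))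
    ...   | inj₂ xˢ≈-1 = x , x≉0 , xˢ≈-1

    f-on-squares : ∀ x → ¬ (x ≈ 0#) → x ^ᶠ s ≈ 1# → f′ x ≈ x ^ᶠ r · c₀
    f-on-squares x x≉0 xˢ≈1 = f-on-roots (trans (xᵛ≈xˢ x x≉0) xˢ≈1)

    f-on-non-squares : ∀ x → ¬ (x ≈ 0#) → x ^ᶠ s ≈ -1# → f′ x ≈ x ^ᶠ r · h F k -1# ^ᶠ t
    f-on-non-squares x x≉0 xˢ≈-1 = *-congˡ (^-cong t (h-cong k (trans (xᵛ≈xˢ x x≉0) xˢ≈-1)))

    f-on-non-squares-odd : ¬ (2 ∣ k) → ∀ x → ¬ (x ≈ 0#) → x ^ᶠ s ≈ -1# → f′ x ≈ x ^ᶠ r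
    f-on-non-squares-odd 2∤k x x≉0 xˢ≈-1 with ¬2∣⇒odd 2∤k
    ... | j , k≡1+j+j = begin
      f′ x                                 ≈⟨ f-on-non-squares x x≉0 xˢ≈-1 ⟩
      x ^ᶠ r · h F k -1# ^ᶠ t              ≡⟨ ≡.cong (λ m → x ^ᶠ r · h F m -1# ^ᶠ t) k≡1+j+j ⟩
      x ^ᶠ r · h F (suc (j + j)) -1# ^ᶠ t  ≈⟨ *-congˡ (trans (^-cong t (h-odd[-1] j)) (1^ t)) ⟩
      x ^ᶠ r · 1#                          ≈⟨ *-identityʳ _ ⟩
      x ^ᶠ r                               ∎

    -- The s-th power of f(x) tells the two classes apart: it is c₀ˢ on squares
    -- and (-1)ʳ on non-squares.
    fˢ-on-squares : ∀ x → ¬ (x ≈ 0#) → x ^ᶠ s ≈ 1# → f′ x ^ᶠ s ≈ c₀ ^ᶠ s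
    fˢ-on-squares x x≉0 xˢ≈1 = begin
      f′ x ^ᶠ s                   ≈⟨ ^-cong s (f-on-squares x x≉0 xˢ≈1) ⟩
      (x ^ᶠ r · c₀) ^ᶠ s          ≈⟨ ·-^ _ c₀ s ⟩
      (x ^ᶠ r) ^ᶠ s · c₀ ^ᶠ s     ≈⟨ *-congʳ (^-swap x r s) ⟩
      (x ^ᶠ s) ^ᶠ r · c₀ ^ᶠ s     ≈⟨ *-congʳ (trans (^-cong r xˢ≈1) (1^ r)) ⟩
      1# · c₀ ^ᶠ s                ≈⟨ *-identityˡ _ ⟩
      c₀ ^ᶠ s                     ∎

    fˢ-on-non-squares : ¬ (2 ∣ k) → ∀ x → ¬ (x ≈ 0#) → x ^ᶠ s ≈ -1# → f′ x ^ᶠ s ≈ -1# ^ᶠ r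
    fˢ-on-non-squares 2∤k x x≉0 xˢ≈-1 = begin
      f′ x ^ᶠ s          ≈⟨ ^-cong s (f-on-non-squares-odd 2∤k x x≉0 xˢ≈-1) ⟩
      (x ^ᶠ r) ^ᶠ s      ≈⟨ ^-swap x r s ⟩
      (x ^ᶠ s) ^ᶠ r      ≈⟨ ^-cong r xˢ≈-1 ⟩
      -1# ^ᶠ r           ∎

    -- (-1)ʳ ≠ (-1)ʳ⁺¹ as p is odd
    -1^r≉-1^[r+1] : ¬ (-1# ^ᶠ r ≈ -1# ^ᶠ suc r)
    -1^r≉-1^[r+1] = σ≉-σ p≢2 (^-nonzero r -1≉0)

    K : ℕ
    K = k ^ (s * t)

    ιK≈c₀ˢ : ι K ≈ c₀ ^ᶠ s
    ιK≈c₀ˢ = trans (ι-^ k (s * t)) (trans (^-* (ι k) s t) (^-swap (ι k) s t))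

    K≡1+pred[K] : K ≡ suc (pred K)
    K≡1+pred[K] = ≡.sym (ℕP.suc-pred K {{Data.Nat.>-nonZero (ℕP.m^n>0 k {{Data.Nat.>-nonZero k≥1}} (s * t))}})

    congruence⇔c₀ˢ : (+ p) ∣ℤ ((+ K) - (- (+ 1)) ^ℤ (r + 1)) ⇔ (c₀ ^ᶠ s ≈ -1# ^ᶠ suc r)
    congruence⇔c₀ˢ = mk⇔ (λ p∣d → trans (sym ιK≈c₀ˢ) (Equivalence.to equivalence p∣d))
                         (λ c₀ˢ≈ → Equivalence.from equivalence (trans ιK≈c₀ˢ c₀ˢ≈))
      where
      equivalence : (+ p) ∣ℤ ((+ K) - (- (+ 1)) ^ℤ (r + 1)) ⇔ (ι K ≈ -1# ^ᶠ suc r)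
      equivalence = ≡.subst (λ K → (+ p) ∣ℤ ((+ K) - (- (+ 1)) ^ℤ (r + 1)) ⇔ (ι K ≈ -1# ^ᶠ suc r))
                            (≡.sym K≡1+pred[K]) (congruence⇔ (pred K) r)

    -- Necessity.  For even k, hₖ(-1) = 0 and f kills a non-square.
    injective⇒k-odd : (∀ x y → f′ x ≈ f′ y → x ≈ y) → ¬ (2 ∣ k)
    injective⇒k-odd f-inj 2∣k with non-square | 2∣⇒even 2∣k
    ... | T , T≉0 , Tˢ≈-1 | j , k≡j+j = T≉0 (f-inj T 0# (begin
      f′ T                              ≈⟨ f-on-non-squares T T≉0 Tˢ≈-1 ⟩
      T ^ᶠ r · h F k -1# ^ᶠ t           ≡⟨ ≡.cong (λ m → T ^ᶠ r · h F m -1# ^ᶠ t) k≡j+j ⟩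
      T ^ᶠ r · h F (j + j) -1# ^ᶠ t     ≈⟨ *-congˡ (^-zero t t≥1 (h-even[-1] j)) ⟩
      T ^ᶠ r · 0#                       ≈⟨ zeroʳ _ ⟩
      0#                                ≈⟨ f-zero ≈-refl ⟨
      f′ 0#                             ∎))

    -- some W ≠ 0 has Wˢ = (-1)ʳ⁺¹: a non-square if r is even, 1 if r is odd
    target : ∃ λ W → ¬ (W ≈ 0#) × W ^ᶠ s ≈ -1# ^ᶠ suc r
    target with even-or-odd r | non-square
    ... | inj₁ (j , refl) | T , T≉0 , Tˢ≈-1 = T , T≉0 , trans Tˢ≈-1 (sym (-1^odd j))
    ... | inj₂ (j , refl) | _ = 1# , 1≉0 , trans (1^ s)
            (sym (≡.subst (λ m → -1# ^ᶠ m ≈ 1#) (≡.cong suc (ℕP.+-suc j j)) (-1^even (suc j))))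

    -- a preimage x of W cannot be a non-square, as (-1)ʳ ≠ Wˢ; so c₀ˢ = f(x)ˢ = Wˢ
    surjective⇒c₀ˢ : (∀ y → ∃ λ x → f′ x ≈ y) → ¬ (2 ∣ k) → c₀ ^ᶠ s ≈ -1# ^ᶠ suc r
    surjective⇒c₀ˢ f-surj 2∤k with target
    ... | W , W≉0 , Wˢ≈-1^[r+1] with f-surj W
    ...   | x , fx≈W with x ≈? 0#
    ...     | yes x≈0 = ⊥-elim (W≉0 (trans (sym fx≈W) (f-zero x≈0)))
    ...     | no  x≉0 with square-class x x≉0
    ...       | inj₁ xˢ≈1  = trans (sym (fˢ-on-squares x x≉0 xˢ≈1)) (trans (^-cong s fx≈W) Wˢ≈-1^[r+1])
    ...       | inj₂ xˢ≈-1 = ⊥-elim (-1^r≉-1^[r+1]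
                   (trans (sym (fˢ-on-non-squares 2∤k x x≉0 xˢ≈-1)) (trans (^-cong s fx≈W) Wˢ≈-1^[r+1])))

    -- Sufficiency.  f(x)ˢ separates the two classes; within a class, f(x) = f(y)
    -- gives xʳ = yʳ, and xˢ = yˢ holds by definition of the class.
    sufficient : ¬ (2 ∣ k) → ¬ (p ∣ k) → gcd r s ≡ 1 → c₀ ^ᶠ s ≈ -1# ^ᶠ suc r → Permutes F f′
    sufficient 2∤k p∤k gcd[r,s]≡1 c₀ˢ≈-1^[r+1] = permutes-from-nonzero f≉0 f-injective
      where
      f≉0 : ∀ x → ¬ (x ≈ 0#) → ¬ (f′ x ≈ 0#)
      f≉0 x x≉0 fx≈0 with square-class x x≉0
      ... | inj₁ xˢ≈1  = ·-nonzero (^-nonzero r x≉0) (c₀≉0 p∤k) (trans (sym (f-on-squares x x≉0 xˢ≈1)) fx≈0)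
      ... | inj₂ xˢ≈-1 = ^-nonzero r x≉0 (trans (sym (f-on-non-squares-odd 2∤k x x≉0 xˢ≈-1)) fx≈0)

      separated : ∀ x y → ¬ (x ≈ 0#) → ¬ (y ≈ 0#) → x ^ᶠ s ≈ 1# → y ^ᶠ s ≈ -1# → ¬ (f′ x ≈ f′ y)
      separated x y x≉0 y≉0 xˢ≈1 yˢ≈-1 fx≈fy = -1^r≉-1^[r+1] (begin
        -1# ^ᶠ r       ≈⟨ fˢ-on-non-squares 2∤k y y≉0 yˢ≈-1 ⟨
        f′ y ^ᶠ s      ≈⟨ ^-cong s fx≈fy ⟨
        f′ x ^ᶠ s      ≈⟨ fˢ-on-squares x x≉0 xˢ≈1 ⟩
        c₀ ^ᶠ s        ≈⟨ c₀ˢ≈-1^[r+1] ⟩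
        -1# ^ᶠ suc r   ∎)

      f-injective : ∀ x y → ¬ (x ≈ 0#) → ¬ (y ≈ 0#) → f′ x ≈ f′ y → x ≈ y
      f-injective x y x≉0 y≉0 fx≈fy with square-class x x≉0 | square-class y y≉0
      ... | inj₁ xˢ≈1 | inj₁ yˢ≈1 = coprime-powers-injective r s gcd[r,s]≡1 y≉0
        (cancelʳ (c₀≉0 p∤k) (trans (sym (f-on-squares x x≉0 xˢ≈1)) (trans fx≈fy (f-on-squares y y≉0 yˢ≈1))))
        (trans xˢ≈1 (sym yˢ≈1))
      ... | inj₂ xˢ≈-1 | inj₂ yˢ≈-1 = coprime-powers-injective r s gcd[r,s]≡1 y≉0
        (trans (sym (f-on-non-squares-odd 2∤k x x≉0 xˢ≈-1)) (trans fx≈fy (f-on-non-squares-odd 2∤k y y≉0 yˢ≈-1)))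
        (trans xˢ≈-1 (sym yˢ≈-1))
      ... | inj₁ xˢ≈1  | inj₂ yˢ≈-1 = ⊥-elim (separated x y x≉0 y≉0 xˢ≈1 yˢ≈-1 fx≈fy)
      ... | inj₂ xˢ≈-1 | inj₁ yˢ≈1  = ⊥-elim (separated y x y≉0 x≉0 yˢ≈1 xˢ≈-1 (sym fx≈fy))

    proposition : Permutes F f′ ⇔
      (gcd k (2 * p) ≡ 1 × gcd r s ≡ 1 × (+ p) ∣ℤ ((+ K) - (- (+ 1)) ^ℤ (r + 1)))
    proposition = mk⇔
      (λ (f-inj , f-surj) →
          ⇒gcd[k,2p]≡1 (injective⇒k-odd f-inj) (injective⇒p∤k f-inj)
        , injective⇒gcd[r,s]≡1 f-inj
        , Equivalence.from congruence⇔c₀ˢ (surjective⇒c₀ˢ f-surj (injective⇒k-odd f-inj)))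
      (λ (gcd[k,2p]≡1 , gcd[r,s]≡1 , congruence) →
        sufficient (proj₁ (gcd[k,2p]≡1⇒ gcd[k,2p]≡1)) (proj₂ (gcd[k,2p]≡1⇒ gcd[k,2p]≡1)) gcd[r,s]≡1
                   (Equivalence.to congruence⇔c₀ˢ congruence))

proposition3p1 : {c ℓ : Level} (p q : ℕ) → Prime p → Σ ℕ (λ n → n ≥ 1 × q ≡ p ^ n) →
    (F : CommutativeRing c ℓ) → IsField F → HasCard F q → HasChar F p →
    (r v k t : ℕ) → r ≥ 1 → v ≥ 1 → k ≥ 1 → t ≥ 1 →
    ((q ∸ 1 ≡ 1 * gcd v (q ∸ 1)) →
      (Permutes F (f F r v k t) ⇔ (gcd k p ≡ 1 × gcd r (gcd v (q ∸ 1)) ≡ 1)))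
    × ((q ∸ 1 ≡ 2 * gcd v (q ∸ 1)) →
      (Permutes F (f F r v k t) ⇔
        (gcd k (2 * p) ≡ 1 × gcd r (gcd v (q ∸ 1)) ≡ 1
          × (+ p) ∣ℤ ((+ (k ^ (gcd v (q ∸ 1) * t))) - ((- (+ 1)) ^ℤ (r + 1))))))
-- q ≠ 0 since a field has an element, and n ≠ 0 by hypothesis
proposition3p1 p zero _ _ F _ (_ , _ , e-surj) _ _ _ _ _ _ _ _ _ with e-surj (CommutativeRing.0# F)
... | () , _
proposition3p1 p (suc N) _ (zero , () , _) _ _ _ _ _ _ _ _ _ _ _ _
proposition3p1 p (suc N) p-prime (suc n , _ , q≡pⁿ) F isField card char r v k t r≥1 _ k≥1 t≥1 =
  Case-d≡1.proposition , Case-d≡2.proposition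
  where open Setting F isField p p-prime N n q≡pⁿ card char r v k t r≥1 k≥1 t≥1 (gcd v N) (gcd-GCD v N)
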